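{- Let $\vec q = (q_0,\dots,q_{m-1})$ be a finite sequence of positive integers with asymmetry type $(c\,;\,\vec x)$, and let $\lambda$ be the length of $\vec x$. Then: (a) $[\vec q]^{\star} = 0$ if and only if $c = 0$, i.e. if and only if $\vec q$ is symmetric; (b) if $\vec q$ is not symmetric, then $[\vec q]^{\star}$ has the same sign as $c$; (c) $|c|\, F_{\lambda+1} \le \left|[\vec q]^{\star}\right|$, where $F_k$ denotes the $k$-th Fibonacci number ($F_1=F_2=1$, $F_{k+1}=F_k+F_{k-1}$).
   Context: Continuants: for a sequence of integers $q_0,\dots,q_{m-1}$ and $0\le i\le j+2\le m+1$, define $[q_i,\dots,q_j]$ recursively by $[q_i,\dots,q_{i-2}]=0$, $[q_i,\dots,q_{i-1}]=1$ (empty sequence), and $[q_i,\dots,q_j] = q_j\,[q_i,\dots,q_{j-1}] + [q_i,\dots,q_{j-2}]$ for $j\ge i$. Anticontinuants: for $0\le i\le j+1\le m$, $[q_i,\dots,q_j]^{\star} := [q_i,\dots,q_{j-1}] - [q_{i+1},\dots,q_j]$, and $[\vec q]^{\star} := [q_0,\dots,q_{m-1}]^{\star}$. Asymmetry type: a finite asymmetric (not equal to its reversal) sequence $\vec q$ of positive integers can be uniquely written as $q_0, \ldots, q_{t-1}, q_t + (-1)^t c, \vec x, q_t, q_{t-1}, \ldots, q_0$ with $c$ a nonzero integer, $t\ge 0$, and $\vec x$ a (possibly empty) sequence of positive integers; it then has asymmetry type $(c\,;\,\vec x)$. A symmetric sequence of even length has type $(0\,;\,)$ and a symmetric sequence of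 odd length with middle entry $x$ has type $(0\,;\,x)$. -}

module Defs where

open import Data.Nat using (ℕ; zero; suc)
import Data.Nat as ℕ
open import Data.Integer using (ℤ; +_; _+_; _-_; _*_; -_; 0ℤ; 1ℤ)
open import Data.List using (List; []; _∷_; _++_; reverse; length; foldl)
open import Data.Product using (_×_; _,_; proj₂)
open import Relation.Binary.PropositionalEquality using (_≡_; _≢_)

-- Continuant [q_0,...,q_{m-1}] computed left to right by the recursion
-- [..q_j] = q_j [..q_{j-1}] + [..q_{j-2}], with [..q_{-2}] = 0, [] = 1.
contStep : ℤ × ℤ → ℕ → ℤ × ℤ
contStep (prev , cur) q = (cur , (+ q) * cur + prev)

cont : List ℕ → ℤ
cont qs = proj₂ (foldl contStep (0ℤ , 1ℤ) qs)

dropLast : List ℕ → List ℕ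
dropLast [] = []
dropLast (x ∷ []) = []
dropLast (x ∷ y ∷ xs) = x ∷ dropLast (y ∷ xs)

-- Anticontinuant [q_0..q_{m-1}]^⋆ = [q_0..q_{m-2}] - [q_1..q_{m-1}];
-- for the empty sequence this is 0 - 0 = 0.
anti : List ℕ → ℤ
anti [] = 0ℤ
anti (q ∷ qs) = cont (dropLast (q ∷ qs)) - cont qs

neg1^ : ℕ → ℤ
neg1^ zero = 1ℤ
neg1^ (suc t) = - neg1^ t

-- AsymType q c xs : the sequence q has asymmetry type (c ; xs).
-- In the asymmetric case, p = q_0..q_{t-1}, a = q_t + (-1)^t c, b = q_t.
data AsymType : List ℕ → ℤ → List ℕ → Set where
  sym-even : ∀ (p : List ℕ) → AsymType (p ++ reverse p) 0ℤ []
  sym-odd  : ∀ (p : List ℕ) (x : ℕ) → AsymType (p ++ x ∷ reverse p) 0ℤ (x ∷ [])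
  asym     : ∀ (p : List ℕ) (a b : ℕ) (c : ℤ) (xs : List ℕ) →
             c ≢ 0ℤ → + a ≡ + b + neg1^ (length p) * c →
             AsymType (p ++ a ∷ xs ++ b ∷ reverse p) c xs

fib : ℕ → ℕ
fib zero = 0
fib (suc zero) = 1
fib (suc (suc n)) = fib (suc n) ℕ.+ fib n

module Submission where

-- Write E x for the matrix ((x,1),(1,0)) and M q = E q₀ ⋯ E q_{m-1}.
-- The (0,0) entry of M q is the continuant [q], and its skew part m01 - m10 is
-- the anticontinuant [q]⋆.

open import Defs
open import Data.Nat using (ℕ; suc)
import Data.Nat as ℕ
open import Data.Integer using (ℤ; 0ℤ; ∣_∣; _<_)
open import Data.List using (List; reverse; length)
open import Data.List.Relation.Unary.All using (All)
open import Data.Product using (_×_)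
open import Data.Sum using (_⊎_)
open import Function.Bundles using (_⇔_)
open import Relation.Binary.PropositionalEquality using (_≡_; _≢_)

open import Data.Nat using (zero; z≤n; s≤s)
import Data.Nat.Properties as ℕP
import Data.Nat.Tactic.RingSolver as ℕRing
open import Data.Integer
  using (+_; _+_; _-_; _*_; -_; 1ℤ; -1ℤ; +[1+_]; -[1+_]; _≤_; +≤+; +<+; -<+)
import Data.Integer.Properties as ℤP
import Data.Integer.Tactic.RingSolver as ℤRing
open import Data.List using ([]; _∷_; _++_; foldl; [_])
open import Data.List.Properties
  using (unfold-reverse; ++-assoc; reverse-++; reverse-involutive; length-reverse)
import Data.List.Relation.Unary.All as All
open All.All using ([]; _∷_)
import Data.List.Relation.Unary.All.Properties as AllP
open import Data.Product using (_,_; proj₁; proj₂)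
open import Data.Sum using (inj₁; inj₂)
open import Data.Empty using (⊥-elim)
open import Function.Base using (_∘_)
open import Function.Bundles using (mk⇔)
open import Relation.Binary.PropositionalEquality
  using (refl; sym; trans; cong; cong₂; subst; subst₂; module ≡-Reasoning)

-- 1. 2×2 integer matrices

record Mat : Set where
  constructor mat
  field
    m00 m01 m10 m11 : ℤ
open Mat

infixr 7 _⊗_

_⊗_ : Mat → Mat → Mat
A ⊗ B = mat (m00 A * m00 B + m01 A * m10 B) (m00 A * m01 B + m01 A * m11 B)
            (m10 A * m00 B + m11 A * m10 B) (m10 A * m01 B + m11 A * m11 B)

Id : Mat
Id = mat 1ℤ 0ℤ 0ℤ 1ℤ

T : Mat → Mat
T A = mat (m00 A) (m10 A) (m01 A) (m11 A)

det : Mat → ℤ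
det A = m00 A * m11 A - m01 A * m10 A

-- the skew part; it is the matrix counterpart of the anticontinuant
skew : Mat → ℤ
skew A = m01 A - m10 A

mat≡ : ∀ {a b c d a′ b′ c′ d′} → a ≡ a′ → b ≡ b′ → c ≡ c′ → d ≡ d′ →
       mat a b c d ≡ mat a′ b′ c′ d′
mat≡ refl refl refl refl = refl

⊗-identityˡ : ∀ A → Id ⊗ A ≡ A
⊗-identityˡ (mat a b c d) = mat≡ (one a c) (one b d) (zero′ a c) (zero′ b d)
  where
  one : ∀ x y → 1ℤ * x + 0ℤ * y ≡ x
  one = ℤRing.solve-∀
  zero′ : ∀ x y → 0ℤ * x + 1ℤ * y ≡ y
  zero′ = ℤRing.solve-∀

⊗-identityʳ : ∀ A → A ⊗ Id ≡ A
⊗-identityʳ (mat a b c d) = mat≡ (left a b) (right a b) (left c d) (right c d)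
  where
  left : ∀ x y → x * 1ℤ + y * 0ℤ ≡ x
  left = ℤRing.solve-∀
  right : ∀ x y → x * 0ℤ + y * 1ℤ ≡ y
  right = ℤRing.solve-∀

⊗-assoc : ∀ A B C → (A ⊗ B) ⊗ C ≡ A ⊗ (B ⊗ C)
⊗-assoc (mat a b c d) (mat e f g h) (mat i j k l) =
  mat≡ (entry a b e f g h i k) (entry a b e f g h j l)
       (entry c d e f g h i k) (entry c d e f g h j l)
  where
  entry : ∀ x y e f g h z w →
    (x * e + y * g) * z + (x * f + y * h) * w ≡ x * (e * z + f * w) + y * (g * z + h * w)
  entry = ℤRing.solve-∀

T-⊗ : ∀ A B → T (A ⊗ B) ≡ T B ⊗ T A
T-⊗ (mat a b c d) (mat e f g h) =
  mat≡ (entry a b e g) (entry c d e g) (entry a b f h) (entry c d f h)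
  where
  entry : ∀ x y z w → x * z + y * w ≡ z * x + w * y
  entry = ℤRing.solve-∀

skew-conjugate : ∀ A B → skew (A ⊗ B ⊗ T A) ≡ det A * skew B
skew-conjugate (mat a b c d) (mat e f g h) = identity a b c d e f g h
  where
  identity : ∀ a b c d e f g h →
    (a * (e * c + f * d) + b * (g * c + h * d)) - (c * (e * a + f * b) + d * (g * a + h * b))
      ≡ (a * d - b * c) * (f - g)
  identity = ℤRing.solve-∀

-- 2. Continuant matrices  M q = E q₀ ⊗ ⋯ ⊗ E q_{m-1}

E : ℕ → Mat
E x = mat (+ x) 1ℤ 1ℤ 0ℤ

M : List ℕ → Mat
M []       = Id
M (x ∷ xs) = E x ⊗ M xs

E-⊗ : ∀ x A → E x ⊗ A ≡ mat (+ x * m00 A + m10 A) (+ x * m01 A + m11 A) (m00 A) (m01 A)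
E-⊗ x (mat a b c d) = mat≡ (top (+ x) a c) (top (+ x) b d) (bottom a c) (bottom b d)
  where
  top : ∀ X u v → X * u + 1ℤ * v ≡ X * u + v
  top = ℤRing.solve-∀
  bottom : ∀ u v → 1ℤ * u + 0ℤ * v ≡ u
  bottom = ℤRing.solve-∀

M-++ : ∀ xs ys → M (xs ++ ys) ≡ M xs ⊗ M ys
M-++ []       ys = sym (⊗-identityˡ (M ys))
M-++ (x ∷ xs) ys = trans (cong (E x ⊗_) (M-++ xs ys)) (sym (⊗-assoc (E x) (M xs) (M ys)))

-- Since each E x is symmetric, reversing the sequence transposes the product.
M-reverse : ∀ xs → M (reverse xs) ≡ T (M xs)
M-reverse []       = refl
M-reverse (x ∷ xs) = begin
  M (reverse (x ∷ xs))         ≡⟨ cong M (unfold-reverse x xs) ⟩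
  M (reverse xs ++ [ x ])      ≡⟨ M-++ (reverse xs) [ x ] ⟩
  M (reverse xs) ⊗ (E x ⊗ Id)  ≡⟨ cong₂ _⊗_ (M-reverse xs) (⊗-identityʳ (E x)) ⟩
  T (M xs) ⊗ T (E x)           ≡⟨ sym (T-⊗ (E x) (M xs)) ⟩
  T (E x ⊗ M xs)               ∎
  where open ≡-Reasoning

-- every factor E x has determinant -1
det-M : ∀ xs → det (M xs) ≡ neg1^ (length xs)
det-M []       = refl
det-M (x ∷ xs) = trans (cong det (E-⊗ x (M xs)))
                       (trans (identity (+ x) (m00 A) (m01 A) (m10 A) (m11 A)) (cong -_ (det-M xs)))
  where
  A = M xs
  identity : ∀ x a b c d → (x * a + c) * b - (x * b + d) * a ≡ - (a * d - b * c)
  identity = ℤRing.solve-∀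

foldl-M : ∀ xs u v → foldl contStep (u , v) xs
                     ≡ (v * m01 (M xs) + u * m11 (M xs) , v * m00 (M xs) + u * m10 (M xs))
foldl-M []       u v = cong₂ _,_ (sym (base₁ u v)) (sym (base₂ u v))
  where
  base₁ : ∀ u v → v * 0ℤ + u * 1ℤ ≡ u
  base₁ = ℤRing.solve-∀
  base₂ : ∀ u v → v * 1ℤ + u * 0ℤ ≡ v
  base₂ = ℤRing.solve-∀
foldl-M (x ∷ xs) u v = trans (foldl-M xs v (+ x * v + u))
  (trans (cong₂ _,_ (step (+ x) u v (m01 A) (m11 A)) (step (+ x) u v (m00 A) (m10 A)))
         (cong (λ B → v * m01 B + u * m11 B , v * m00 B + u * m10 B) (sym (E-⊗ x A))))
  where
  A = M xs
  step : ∀ x u v a b → (x * v + u) * a + v * b ≡ v * (x * a + b) + u * a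
  step = ℤRing.solve-∀

cont-M : ∀ xs → cont xs ≡ m00 (M xs)
cont-M xs = trans (cong proj₂ (foldl-M xs 0ℤ 1ℤ)) (identity (m00 (M xs)) (m10 (M xs)))
  where
  identity : ∀ a b → 1ℤ * a + 0ℤ * b ≡ a
  identity = ℤRing.solve-∀

-- The first component of the fold state lags one entry behind the second.
foldl-lag : ∀ st x xs → proj₁ (foldl contStep st (x ∷ xs))
                        ≡ proj₂ (foldl contStep st (dropLast (x ∷ xs)))
foldl-lag st x []       = refl
foldl-lag st x (y ∷ ys) = foldl-lag (contStep st x) y ys

anti-M : ∀ xs → anti xs ≡ skew (M xs)
anti-M []       = refl
anti-M (x ∷ xs) = begin
  cont (dropLast (x ∷ xs)) - cont xs
    ≡⟨ cong₂ _-_ (sym (foldl-lag (0ℤ , 1ℤ) x xs)) (cont-M xs) ⟩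
  proj₁ (foldl contStep (0ℤ , 1ℤ) (x ∷ xs)) - m00 (M xs)
    ≡⟨ cong (λ st → proj₁ st - m00 (M xs)) (foldl-M (x ∷ xs) 0ℤ 1ℤ) ⟩
  (1ℤ * m01 A + 0ℤ * m11 A) - m00 (M xs)
    ≡⟨ cong₂ (λ u w → u - w) (identity (m01 A) (m11 A)) (cong m10 (sym (E-⊗ x (M xs)))) ⟩
  skew A ∎
  where
  open ≡-Reasoning
  A = M (x ∷ xs)
  identity : ∀ a b → 1ℤ * a + 0ℤ * b ≡ a
  identity = ℤRing.solve-∀

-- 3. Algebraic consequences for anticontinuants

-- reversal transposes M xs and hence negates the anticontinuant
anti-reverse : ∀ xs → anti (reverse xs) ≡ - anti xs
anti-reverse xs = begin
  anti (reverse xs)     ≡⟨ anti-M (reverse xs) ⟩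
  skew (M (reverse xs)) ≡⟨ cong skew (M-reverse xs) ⟩
  m10 A - m01 A         ≡⟨ identity (m01 A) (m10 A) ⟩
  - skew A              ≡⟨ cong -_ (sym (anti-M xs)) ⟩
  - anti xs             ∎
  where
  open ≡-Reasoning
  A = M xs
  identity : ∀ a b → b - a ≡ - (a - b)
  identity = ℤRing.solve-∀

self-negative : ∀ {i} → i ≡ - i → i ≡ 0ℤ
self-negative {+ zero} _ = refl

palindrome-anti : ∀ {xs} → xs ≡ reverse xs → anti xs ≡ 0ℤ
palindrome-anti {xs} xs≡rev = self-negative (trans (cong anti xs≡rev) (anti-reverse xs))

anti-surround : ∀ p Y → anti (p ++ Y ++ reverse p) ≡ neg1^ (length p) * skew (M Y)
anti-surround p Y = begin
  anti (p ++ Y ++ reverse p)               ≡⟨ anti-M (p ++ Y ++ reverse p) ⟩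
  skew (M (p ++ Y ++ reverse p))           ≡⟨ cong skew (M-++ p (Y ++ reverse p)) ⟩
  skew (M p ⊗ M (Y ++ reverse p))          ≡⟨ cong (λ B → skew (M p ⊗ B)) (M-++ Y (reverse p)) ⟩
  skew (M p ⊗ M Y ⊗ M (reverse p))         ≡⟨ cong (λ B → skew (M p ⊗ M Y ⊗ B)) (M-reverse p) ⟩
  skew (M p ⊗ M Y ⊗ T (M p))               ≡⟨ skew-conjugate (M p) (M Y) ⟩
  det (M p) * skew (M Y)                   ≡⟨ cong (_* skew (M Y)) (det-M p) ⟩
  neg1^ (length p) * skew (M Y)            ∎
  where open ≡-Reasoning

skew-bordered : ∀ a b A → skew (E a ⊗ A ⊗ E b) ≡ (+ a - + b) * m00 A - skew A
skew-bordered a b (mat k l r s) = identity (+ a) (+ b) k l r s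
  where
  identity : ∀ a b k l r s →
    (a * (k * 1ℤ + l * 0ℤ) + 1ℤ * (r * 1ℤ + s * 0ℤ)) - (1ℤ * (k * b + l * 1ℤ) + 0ℤ * (r * b + s * 1ℤ))
      ≡ (a - b) * k - (l - r)
  identity = ℤRing.solve-∀

anti-asymmetric : ∀ p a b c xs → + a ≡ + b + neg1^ (length p) * c →
  let s = neg1^ (length p) in
  anti (p ++ a ∷ xs ++ b ∷ reverse p) ≡ s * ((s * c) * m00 (M xs) - skew (M xs))
anti-asymmetric p a b c xs a≡b+sc = begin
  anti (p ++ a ∷ xs ++ b ∷ reverse p)
    ≡⟨ cong (λ ys → anti (p ++ a ∷ ys)) (sym (++-assoc xs [ b ] (reverse p))) ⟩
  anti (p ++ (a ∷ xs ++ [ b ]) ++ reverse p)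
    ≡⟨ anti-surround p (a ∷ xs ++ [ b ]) ⟩
  s * skew (E a ⊗ M (xs ++ [ b ]))
    ≡⟨ cong (λ B → s * skew (E a ⊗ B)) (trans (M-++ xs [ b ]) (cong (M xs ⊗_) (⊗-identityʳ (E b)))) ⟩
  s * skew (E a ⊗ M xs ⊗ E b)
    ≡⟨ cong (s *_) (skew-bordered a b (M xs)) ⟩
  s * ((+ a - + b) * m00 (M xs) - skew (M xs))
    ≡⟨ cong (λ d → s * (d * m00 (M xs) - skew (M xs))) a-b≡sc ⟩
  s * ((s * c) * m00 (M xs) - skew (M xs)) ∎
  where
  open ≡-Reasoning
  s = neg1^ (length p)
  cancel : ∀ b d → (b + d) - b ≡ d
  cancel = ℤRing.solve-∀
  a-b≡sc : + a - + b ≡ s * c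
  a-b≡sc = trans (cong (_- + b) a≡b+sc) (cancel (+ b) (s * c))

neg1^-cases : ∀ t → neg1^ t ≡ 1ℤ ⊎ neg1^ t ≡ -1ℤ
neg1^-cases zero    = inj₁ refl
neg1^-cases (suc t) with neg1^-cases t
... | inj₁ s≡1  = inj₂ (cong -_ s≡1)
... | inj₂ s≡-1 = inj₁ (cong -_ s≡-1)

-- 4. Size estimates: continuant matrices of positive sequences are dominated

Positive : List ℕ → Set
Positive = All (0 ℕ.<_)

All-reverse : ∀ {P : ℕ → Set} {xs} → All P xs → All P (reverse xs)
All-reverse {xs = []}     []         = []
All-reverse {xs = x ∷ xs} (px ∷ pxs) =
  subst (All _) (sym (unfold-reverse x xs)) (AllP.∷ʳ⁺ (All-reverse pxs) px)

K : List ℕ → ℕ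
K []           = 1
K (x ∷ [])     = x
K (x ∷ y ∷ zs) = x ℕ.* K (y ∷ zs) ℕ.+ K zs

m00-M : ∀ xs → m00 (M xs) ≡ + K xs
m00-M []           = refl
m00-M (x ∷ [])     = trans (cong m00 (E-⊗ x Id))
                           (trans (ℤP.+-identityʳ (+ x * 1ℤ)) (ℤP.*-identityʳ (+ x)))
m00-M (x ∷ y ∷ zs) = begin
  m00 (E x ⊗ M (y ∷ zs))               ≡⟨ cong m00 (E-⊗ x (M (y ∷ zs))) ⟩
  + x * m00 (M (y ∷ zs)) + m10 (E y ⊗ M zs)
    ≡⟨ cong₂ (λ u w → + x * u + w) (m00-M (y ∷ zs)) (trans (cong m10 (E-⊗ y (M zs))) (m00-M zs)) ⟩
  + x * + K (y ∷ zs) + + K zs          ≡⟨ cong (_+ + K zs) (sym (ℤP.pos-* x (K (y ∷ zs)))) ⟩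
  + (x ℕ.* K (y ∷ zs)) + + K zs        ≡⟨ sym (ℤP.pos-+ (x ℕ.* K (y ∷ zs)) (K zs)) ⟩
  + K (x ∷ y ∷ zs)                     ∎
  where open ≡-Reasoning

K-growth : ∀ {x ys} → 0 ℕ.< x → Positive ys → K ys ℕ.+ fib (length ys) ℕ.≤ K (x ∷ ys)
fib≤K : ∀ {xs} → Positive xs → fib (suc (length xs)) ℕ.≤ K xs

K-growth {x} {[]}     0<x []           = 0<x
K-growth {suc x} {y ∷ zs} _ (_ ∷ pzs) =
  ℕP.+-mono-≤ (ℕP.m≤n*m (K (y ∷ zs)) (suc x)) (fib≤K pzs)

fib≤K {[]}     []         = ℕP.≤-refl
fib≤K {x ∷ ys} (px ∷ pys) =
  ℕP.≤-trans (ℕP.+-monoˡ-≤ (fib (length ys)) (fib≤K pys)) (K-growth px pys)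

-- F_{n+1} ≥ 1, which makes the sign of the estimate strict
fib-positive : ∀ n → 0 ℕ.< fib (suc n)
fib-positive zero    = s≤s z≤n
fib-positive (suc n) = ℕP.≤-trans (fib-positive n) (ℕP.m≤m+n (fib (suc n)) (fib n))

-- The off-diagonal entries of M xs are continuants of length |xs| - 1, hence at
-- least F_{|xs|}; the (0,1) entry is handled by reversal.
m10-lower : ∀ {xs} → Positive xs → + fib (length xs) ≤ m10 (M xs)
m10-lower {[]}     []         = +≤+ z≤n
m10-lower {x ∷ ys} (_ ∷ pys) =
  subst (+ fib (suc (length ys)) ≤_)
        (sym (trans (cong m10 (E-⊗ x (M ys))) (m00-M ys))) (+≤+ (fib≤K pys))

m01-lower : ∀ {xs} → Positive xs → + fib (length xs) ≤ m01 (M xs)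
m01-lower {xs} pxs =
  subst₂ (λ n B → + fib n ≤ m10 B) (length-reverse xs) (M-reverse xs) (m10-lower (All-reverse pxs))

-- One half of the anticontinuant bound:  F_{|xs|+1} - [xs]⋆ ≤ [xs].
minus-skew-bound : ∀ {xs} → Positive xs →
  + fib (suc (length xs)) + m10 (M xs) ≤ m00 (M xs) + m01 (M xs)
minus-skew-bound {[]}     []         = ℤP.≤-refl
minus-skew-bound {x ∷ ys} pxs@(px ∷ pys) = begin
  + (f₁ ℕ.+ f₀) + m10 (M (x ∷ ys))
    ≡⟨ cong (λ w → + (f₁ ℕ.+ f₀) + w) (trans (cong m10 (E-⊗ x (M ys))) (m00-M ys)) ⟩
  + (f₁ ℕ.+ f₀) + + K ys
    ≡⟨ regroup f₁ f₀ (K ys) ⟩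
  + (K ys ℕ.+ f₀) + + f₁
    ≤⟨ ℤP.+-mono-≤ (+≤+ (K-growth px pys)) (m01-lower pxs) ⟩
  + K (x ∷ ys) + m01 (M (x ∷ ys))
    ≡⟨ cong (_+ m01 (M (x ∷ ys))) (sym (m00-M (x ∷ ys))) ⟩
  m00 (M (x ∷ ys)) + m01 (M (x ∷ ys)) ∎
  where
  open ℤP.≤-Reasoning
  f₁ = fib (suc (length ys))
  f₀ = fib (length ys)
  swap : ∀ a b c → (a ℕ.+ b) ℕ.+ c ≡ (c ℕ.+ b) ℕ.+ a
  swap = ℕRing.solve-∀
  regroup : ∀ a b c → + (a ℕ.+ b) + + c ≡ + (c ℕ.+ b) + + a
  regroup a b c = trans (sym (ℤP.pos-+ (a ℕ.+ b) c))
                        (trans (cong +_ (swap a b c)) (ℤP.pos-+ (c ℕ.+ b) a))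

-- A is F-dominated when F ≤ m00 A and F + |skew A| ≤ m00 A.
record Dominated (F : ℕ) (A : Mat) : Set where
  field
    diagonal   : + F ≤ m00 A
    plus-skew  : + F + m01 A ≤ m00 A + m10 A
    minus-skew : + F + m10 A ≤ m00 A + m01 A

transpose-dominated : ∀ {F A} → Dominated F A → Dominated F (T A)
transpose-dominated dom = record { diagonal = diagonal ; plus-skew = minus-skew ; minus-skew = plus-skew }
  where open Dominated dom

-- The other half of the bound is the first half for the reversed sequence.
M-dominated : ∀ {xs} → Positive xs → Dominated (fib (suc (length xs))) (M xs)
M-dominated {xs} pxs = record
  { diagonal   = subst (+ fib (suc (length xs)) ≤_) (sym (m00-M xs)) (+≤+ (fib≤K pxs))
  ; plus-skew  = subst₂ (λ n B → + fib (suc n) + m10 B ≤ m00 B + m01 B)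
                        (length-reverse xs) (M-reverse xs) (minus-skew-bound (All-reverse pxs))
  ; minus-skew = minus-skew-bound pxs
  }

-- 5. The integer estimate

SameSign : ℤ → ℤ → Set
SameSign c X = ((0ℤ < c) × (0ℤ < X)) ⊎ ((c < 0ℤ) × (X < 0ℤ))

Estimate : ℤ → ℕ → ℤ → Set
Estimate c F X = SameSign c X × (∣ c ∣ ℕ.* F ℕ.≤ ∣ X ∣)

same-sign-nonzero : ∀ {c X} → SameSign c X → X ≢ 0ℤ
same-sign-nonzero (inj₁ (_ , 0<X)) refl = ℤP.<-irrefl refl 0<X
same-sign-nonzero (inj₂ (_ , X<0)) refl = ℤP.<-irrefl refl X<0

+≤⇒≤∣∣ : ∀ {m i} → + m ≤ i → m ℕ.≤ ∣ i ∣
+≤⇒≤∣∣ (+≤+ m≤n) = m≤n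

≤-shift : ∀ a b c d → a + b ≤ c + d → a ≤ c - (b - d)
≤-shift a b c d h =
  ℤP.0≤i-j⇒j≤i (subst (0ℤ ≤_) (identity a b c d) (ℤP.i≤j⇒0≤j-i h))
  where
  identity : ∀ a b c d → (c + d) - (a + b) ≡ (c - (b - d)) - a
  identity = ℤRing.solve-∀

-- For a positive multiplier (1 + n):  (1 + n) F ≤ (1 + n) m00 A - skew A,
-- since m00 A - skew A ≥ F and n m00 A ≥ n F.
multiple-bound : ∀ {F A} n → Dominated F A → + (suc n ℕ.* F) ≤ +[1+ n ] * m00 A - skew A
multiple-bound {F} {A} n dom = begin
  + (F ℕ.+ n ℕ.* F)              ≡⟨ ℤP.pos-+ F (n ℕ.* F) ⟩
  + F + + (n ℕ.* F)              ≡⟨ cong (λ w → + F + w) (ℤP.pos-* n F) ⟩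
  + F + + n * + F                ≤⟨ ℤP.+-mono-≤ F≤m00-skew (ℤP.*-monoˡ-≤-nonNeg (+ n) diagonal) ⟩
  (m00 A - skew A) + + n * m00 A ≡⟨ identity (m00 A) (skew A) (+ n) ⟩
  +[1+ n ] * m00 A - skew A      ∎
  where
  open ℤP.≤-Reasoning
  open Dominated dom
  F≤m00-skew : + F ≤ m00 A - skew A
  F≤m00-skew = ≤-shift (+ F) (m01 A) (m00 A) (m10 A) plus-skew
  identity : ∀ k e n → (k - e) + n * k ≡ (1ℤ + n) * k - e
  identity = ℤRing.solve-∀

dominance : ∀ {F A} c → c ≢ 0ℤ → 0 ℕ.< F → Dominated F A → Estimate c F (c * m00 A - skew A)
dominance (+ zero)  c≢0 _ _ = ⊥-elim (c≢0 refl)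
dominance {suc f} {A} +[1+ n ] _ _ dom =
  inj₁ (+<+ (s≤s z≤n) , ℤP.<-≤-trans (+<+ (s≤s z≤n)) bound) , +≤⇒≤∣∣ bound
  where
  bound : + (suc n ℕ.* suc f) ≤ +[1+ n ] * m00 A - skew A
  bound = multiple-bound n dom
dominance {suc f} {A} -[1+ n ] _ _ dom =
  inj₂ (-<+ , ℤP.neg-cancel-< {0ℤ} (ℤP.<-≤-trans (+<+ (s≤s z≤n)) bound))
  , subst (suc n ℕ.* suc f ℕ.≤_) (ℤP.∣-i∣≡∣i∣ (-[1+ n ] * m00 A - skew A)) (+≤⇒≤∣∣ bound)
  where
  identity : ∀ c k a b → c * k - (b - a) ≡ - ((- c) * k - (a - b))
  identity = ℤRing.solve-∀
  bound : + (suc n ℕ.* suc f) ≤ - (-[1+ n ] * m00 A - skew A)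
  bound = subst (+ (suc n ℕ.* suc f) ≤_) (identity +[1+ n ] (m00 A) (m01 A) (m10 A))
                (multiple-bound n (transpose-dominated dom))

asymmetric-estimate : ∀ p a b c xs → Positive xs → c ≢ 0ℤ → + a ≡ + b + neg1^ (length p) * c →
  Estimate c (fib (suc (length xs))) (anti (p ++ a ∷ xs ++ b ∷ reverse p))
asymmetric-estimate p a b c xs pxs c≢0 a≡b+sc =
  subst (Estimate c F) (sym (anti-asymmetric p a b c xs a≡b+sc)) (by-sign (neg1^-cases (length p)))
  where
  F = fib (suc (length xs))
  A = M xs
  s = neg1^ (length p)
  dom : Dominated F A
  dom = M-dominated pxs
  Goal : ℤ → Set
  Goal t = Estimate c F (t * ((t * c) * m00 A - skew A))
  plus : ∀ c k a b → 1ℤ * ((1ℤ * c) * k - (a - b)) ≡ c * k - (a - b)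
  plus = ℤRing.solve-∀
  minus : ∀ c k a b → -1ℤ * ((-1ℤ * c) * k - (a - b)) ≡ c * k - (b - a)
  minus = ℤRing.solve-∀
  by-sign : s ≡ 1ℤ ⊎ s ≡ -1ℤ → Goal s
  by-sign (inj₁ s≡1) = subst Goal (sym s≡1)
    (subst (Estimate c F) (sym (plus c (m00 A) (m01 A) (m10 A)))
           (dominance c c≢0 (fib-positive (length xs)) dom))
  by-sign (inj₂ s≡-1) = subst Goal (sym s≡-1)
    (subst (Estimate c F) (sym (minus c (m00 A) (m01 A) (m10 A)))
           (dominance c c≢0 (fib-positive (length xs)) (transpose-dominated dom)))

even-palindrome : ∀ (p : List ℕ) → p ++ reverse p ≡ reverse (p ++ reverse p)
even-palindrome p = sym (begin
  reverse (p ++ reverse p)           ≡⟨ reverse-++ p (reverse p) ⟩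
  reverse (reverse p) ++ reverse p   ≡⟨ cong (_++ reverse p) (reverse-involutive p) ⟩
  p ++ reverse p                     ∎)
  where open ≡-Reasoning

odd-palindrome : ∀ (p : List ℕ) x → p ++ x ∷ reverse p ≡ reverse (p ++ x ∷ reverse p)
odd-palindrome p x = sym (begin
  reverse (p ++ x ∷ reverse p)             ≡⟨ reverse-++ p (x ∷ reverse p) ⟩
  reverse (x ∷ reverse p) ++ reverse p     ≡⟨ cong (_++ reverse p) (unfold-reverse x (reverse p)) ⟩
  (reverse (reverse p) ++ [ x ]) ++ reverse p
    ≡⟨ cong (λ r → (r ++ [ x ]) ++ reverse p) (reverse-involutive p) ⟩
  (p ++ [ x ]) ++ reverse p                ≡⟨ ++-assoc p [ x ] (reverse p) ⟩
  p ++ x ∷ reverse p                       ∎)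
  where open ≡-Reasoning

Conclusion : List ℕ → ℤ → List ℕ → Set
Conclusion q c xs =
  ((anti q ≡ 0ℤ) ⇔ (c ≡ 0ℤ)) × ((c ≡ 0ℤ) ⇔ (q ≡ reverse q))
  × (q ≢ reverse q → SameSign c (anti q))
  × (∣ c ∣ ℕ.* fib (suc (length xs)) ℕ.≤ ∣ anti q ∣)

symmetric-case : ∀ {q} xs → q ≡ reverse q → Conclusion q 0ℤ xs
symmetric-case _ q≡rev =
  mk⇔ (λ _ → refl) (λ _ → palindrome-anti q≡rev) , mk⇔ (λ _ → q≡rev) (λ _ → refl)
  , (λ q≢rev → ⊥-elim (q≢rev q≡rev)) , z≤n

-- For c ≠ 0 everything follows from the estimate, since then [q]⋆ ≠ 0 and so
-- q cannot be a palindrome.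
asymmetric-case : ∀ {q c} xs → c ≢ 0ℤ → Estimate c (fib (suc (length xs))) (anti q) → Conclusion q c xs
asymmetric-case {q} _ c≢0 (sign , size) =
  mk⇔ (⊥-elim ∘ anti≢0) (⊥-elim ∘ c≢0) , mk⇔ (⊥-elim ∘ c≢0) (⊥-elim ∘ anti≢0 ∘ palindrome-anti)
  , (λ _ → sign) , size
  where
  anti≢0 : anti q ≢ 0ℤ
  anti≢0 = same-sign-nonzero sign

proposition1 : (q : List ℕ) (c : ℤ) (xs : List ℕ) →
    All (λ n → 0 ℕ.< n) q → AsymType q c xs →
    ((anti q ≡ 0ℤ) ⇔ (c ≡ 0ℤ)) × ((c ≡ 0ℤ) ⇔ (q ≡ reverse q))
    × (q ≢ reverse q → ((0ℤ < c) × (0ℤ < anti q)) ⊎ ((c < 0ℤ) × (anti q < 0ℤ)))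
    × (∣ c ∣ ℕ.* fib (suc (length xs)) ℕ.≤ ∣ anti q ∣)
proposition1 .(p ++ reverse p) .0ℤ .[] _ (sym-even p) = symmetric-case [] (even-palindrome p)
proposition1 .(p ++ x ∷ reverse p) .0ℤ .(x ∷ []) _ (sym-odd p x) = symmetric-case [ x ] (odd-palindrome p x)
proposition1 .(p ++ a ∷ xs ++ b ∷ reverse p) c xs pq (asym p a b .c .xs c≢0 a≡b+sc) =
  asymmetric-case xs c≢0 (asymmetric-estimate p a b c xs pxs c≢0 a≡b+sc)
  where
  pxs : Positive xs
  pxs = AllP.++⁻ˡ xs (All.tail (AllP.++⁻ʳ p pq))
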